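{- Let $n\in\mathbb{N}$. The coefficients of $p_n(x)$ satisfy $c_{n,2^{n+1}}=1$ and, for every $j\in\{1,2,\dots,2^n\}$, $$c_{n,2(2^n-j)}=-\sum_{i=2^n-j+1}^{2^n}\binom{2i}{j+i-2^n}\,c_{n,2i}.$$ (Thus the coefficients $c_{n,2(2^n-j)}$ are determined recursively in $j$ from $0$ to $2^n$.)
   Context: The polynomials $p_n(x)\in\mathbb{Z}[x]$ are defined by $p_0(x)=x^2-2$ and $p_n(x)=p_{n-1}(x)^2-2$ for $n\ge1$. For $n,k\in\mathbb{N}$, $c_{n,k}$ denotes the coefficient of $x^k$ in $p_n(x)$. -}

module Defs where

open import Data.Nat using (ℕ; zero; suc)
import Data.Nat as ℕ
open import Data.Integer using (ℤ; +_; _+_; _*_; -_)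
open import Data.List using (List; []; _∷_)
open import Data.Nat.Combinatorics using (_C_)

-- Polynomials in ℤ[x] as little-endian coefficient lists: a₀ ∷ a₁ ∷ … represents a₀ + a₁x + …
Poly : Set
Poly = List ℤ

coeff : Poly → ℕ → ℤ
coeff []       _       = + 0
coeff (a ∷ _)  zero    = a
coeff (_ ∷ as) (suc k) = coeff as k

_⊕_ : Poly → Poly → Poly
[]       ⊕ q        = q
(a ∷ as) ⊕ []       = a ∷ as
(a ∷ as) ⊕ (b ∷ bs) = (a + b) ∷ (as ⊕ bs)

scale : ℤ → Poly → Poly
scale c []       = []
scale c (a ∷ as) = (c * a) ∷ scale c as

_⊗_ : Poly → Poly → Poly
[]       ⊗ q = []
(a ∷ as) ⊗ q = scale a q ⊕ (+ 0 ∷ (as ⊗ q))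

sqMinus2 : Poly → Poly
sqMinus2 q = (q ⊗ q) ⊕ (- (+ 2) ∷ [])

p : ℕ → Poly
p zero    = - (+ 2) ∷ + 0 ∷ + 1 ∷ []
p (suc n) = sqMinus2 (p n)

c : ℕ → ℕ → ℤ
c n k = coeff (p n) k

-- Σ_{i=a}^{b} f i  (empty, i.e. 0, if b < a)
sumFromTo : ℕ → ℕ → (ℕ → ℤ) → ℤ
sumFromTo a b f = go (suc b ℕ.∸ a)
  where
  go : ℕ → ℤ
  go zero    = + 0
  go (suc m) = f (a ℕ.+ m) + go m

{-# OPTIONS --safe #-}
module Submission where

-- Substitute x = t + t⁻¹. Then p₀(x) = t² + t⁻², and squaring and subtracting 2 doubles
-- the exponent, so pₙ(t + t⁻¹) = t^D + t^(-D) with D = 2^(n+1) = deg pₙ. Multiplying by t^D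
-- gives the polynomial identity  Σₖ c_{n,k} t^(D-k) (1+t²)^k = t^(2D) + 1.  The term of index k
-- only has powers of t of the parity of k, and for k = 2i the coefficient of t^(2j) in it is
-- C(2i, i + j - 2ⁿ) (zero for i < 2ⁿ - j). Comparing coefficients of t^(2j) for 0 < j ≤ 2ⁿ,
-- where the right side vanishes, gives the recurrence; comparing constant terms gives c_{n,D} = 1.

open import Defs
open import Data.Nat using (ℕ; zero; suc; z≤n; s≤s; _≤_; _<_; _^_; _∸_; _+_; _*_)
import Data.Nat as ℕ
import Data.Nat.Properties as ℕₚ
open import Data.Nat.Combinatorics using (_C_; nCk+nC[k+1]≡[n+1]C[k+1])
open import Data.Integer using (ℤ; +_; -_)
import Data.Integer as ℤ
import Data.Integer.Properties as ℤₚ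
open import Data.Integer.Tactic.RingSolver using (solve-∀)
open import Data.Nat.Tactic.RingSolver using () renaming (solve-∀ to ℕ-solve-∀)
open import Algebra.Properties.AbelianGroup ℤₚ.+-0-abelianGroup using (inverseˡ-unique)
open import Data.List using ([]; _∷_; length)
open import Data.Product using (_×_; _,_)
open import Level using (0ℓ)
open import Relation.Binary.Bundles using (Setoid)
open import Relation.Binary.Structures using (IsEquivalence)
open import Relation.Binary.PropositionalEquality
import Relation.Binary.Reasoning.Setoid as SetoidReasoning

one : Poly
one = + 1 ∷ []

-- Lists differing by trailing zeros denote the same polynomial, so polynomials are compared
-- coefficientwise.
infix 4 _≈_
record _≈_ (q r : Poly) : Set where
  constructor coeffwise
  field coeff-≡ : ∀ k → coeff q k ≡ coeff r k
open _≈_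

≈-isEquivalence : IsEquivalence _≈_
≈-isEquivalence = record
  { refl  = coeffwise λ _ → refl
  ; sym   = λ q≈r → coeffwise λ k → sym (coeff-≡ q≈r k)
  ; trans = λ q≈r r≈s → coeffwise λ k → trans (coeff-≡ q≈r k) (coeff-≡ r≈s k)
  }

≈-setoid : Setoid 0ℓ 0ℓ
≈-setoid = record { isEquivalence = ≈-isEquivalence }

open IsEquivalence ≈-isEquivalence
  using () renaming (refl to ≈-refl; sym to ≈-sym; trans to ≈-trans; reflexive to ≡⇒≈)

module ≈-Reasoning = SetoidReasoning ≈-setoid

private
  variable
    a b : ℤ
    q q′ r r′ : Poly

coeff-⊕ : ∀ q r k → coeff (q ⊕ r) k ≡ coeff q k ℤ.+ coeff r k
coeff-⊕ []      r       k       = sym (ℤₚ.+-identityˡ _)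
coeff-⊕ (a ∷ q) []      k       = sym (ℤₚ.+-identityʳ _)
coeff-⊕ (a ∷ q) (b ∷ r) zero    = refl
coeff-⊕ (a ∷ q) (b ∷ r) (suc k) = coeff-⊕ q r k

coeff-scale : ∀ a q k → coeff (scale a q) k ≡ a ℤ.* coeff q k
coeff-scale a []      k       = sym (ℤₚ.*-zeroʳ a)
coeff-scale a (b ∷ q) zero    = refl
coeff-scale a (b ∷ q) (suc k) = coeff-scale a q k

∷-cong : a ≡ b → q ≈ r → a ∷ q ≈ b ∷ r
∷-cong a≡b q≈r = coeffwise λ { zero → a≡b ; (suc k) → coeff-≡ q≈r k }

∷-congʳ : q ≈ r → a ∷ q ≈ a ∷ r
∷-congʳ = ∷-cong refl

∷-≈[] : a ≡ + 0 → q ≈ [] → a ∷ q ≈ []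
∷-≈[] a≡0 q≈[] = coeffwise λ { zero → a≡0 ; (suc k) → coeff-≡ q≈[] k }

∷-≈-∷-tail : a ∷ q ≈ b ∷ r → q ≈ r
∷-≈-∷-tail a∷q≈b∷r = coeffwise λ k → coeff-≡ a∷q≈b∷r (suc k)

∷-≈[]-head : a ∷ q ≈ [] → a ≡ + 0
∷-≈[]-head a∷q≈[] = coeff-≡ a∷q≈[] 0

∷-≈[]-tail : a ∷ q ≈ [] → q ≈ []
∷-≈[]-tail a∷q≈[] = coeffwise λ k → coeff-≡ a∷q≈[] (suc k)

⊕-cong : q ≈ q′ → r ≈ r′ → q ⊕ r ≈ q′ ⊕ r′
⊕-cong {q} {q′} {r} {r′} q≈q′ r≈r′ = coeffwise λ k → begin
  coeff (q ⊕ r) k            ≡⟨ coeff-⊕ q r k ⟩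
  coeff q k ℤ.+ coeff r k    ≡⟨ cong₂ ℤ._+_ (coeff-≡ q≈q′ k) (coeff-≡ r≈r′ k) ⟩
  coeff q′ k ℤ.+ coeff r′ k  ≡⟨ coeff-⊕ q′ r′ k ⟨
  coeff (q′ ⊕ r′) k          ∎
  where open ≡-Reasoning

⊕-congʳ : ∀ q → r ≈ r′ → q ⊕ r ≈ q ⊕ r′
⊕-congʳ q = ⊕-cong (≈-refl {q})

⊕-congˡ : ∀ r → q ≈ q′ → q ⊕ r ≈ q′ ⊕ r
⊕-congˡ r q≈q′ = ⊕-cong q≈q′ (≈-refl {r})

scale-cong : q ≈ r → scale a q ≈ scale a r
scale-cong {q} {r} {a} q≈r = coeffwise λ k → begin
  coeff (scale a q) k   ≡⟨ coeff-scale a q k ⟩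
  a ℤ.* coeff q k       ≡⟨ cong (a ℤ.*_) (coeff-≡ q≈r k) ⟩
  a ℤ.* coeff r k       ≡⟨ coeff-scale a r k ⟨
  coeff (scale a r) k   ∎
  where open ≡-Reasoning

⊕-identityʳ : ∀ q → q ⊕ [] ≡ q
⊕-identityʳ []      = refl
⊕-identityʳ (a ∷ q) = refl

⊕-interchange : ∀ q r q′ r′ → (q ⊕ r) ⊕ (q′ ⊕ r′) ≈ (q ⊕ q′) ⊕ (r ⊕ r′)
⊕-interchange q r q′ r′ = coeffwise λ k → begin
  coeff ((q ⊕ r) ⊕ (q′ ⊕ r′)) k
    ≡⟨ trans (coeff-⊕ (q ⊕ r) (q′ ⊕ r′) k) (cong₂ ℤ._+_ (coeff-⊕ q r k) (coeff-⊕ q′ r′ k)) ⟩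
  (coeff q k ℤ.+ coeff r k) ℤ.+ (coeff q′ k ℤ.+ coeff r′ k)
    ≡⟨ interchange (coeff q k) (coeff r k) (coeff q′ k) (coeff r′ k) ⟩
  (coeff q k ℤ.+ coeff q′ k) ℤ.+ (coeff r k ℤ.+ coeff r′ k)
    ≡⟨ trans (coeff-⊕ (q ⊕ q′) (r ⊕ r′) k) (cong₂ ℤ._+_ (coeff-⊕ q q′ k) (coeff-⊕ r r′ k)) ⟨
  coeff ((q ⊕ q′) ⊕ (r ⊕ r′)) k
    ∎
  where
  open ≡-Reasoning
  interchange : ∀ w x y z → (w ℤ.+ x) ℤ.+ (y ℤ.+ z) ≡ (w ℤ.+ y) ℤ.+ (x ℤ.+ z)
  interchange = solve-∀

scale-distribˡ : ∀ a q r → scale a (q ⊕ r) ≡ scale a q ⊕ scale a r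
scale-distribˡ a []      r       = refl
scale-distribˡ a (b ∷ q) []      = refl
scale-distribˡ a (b ∷ q) (c ∷ r) = cong₂ _∷_ (ℤₚ.*-distribˡ-+ a b c) (scale-distribˡ a q r)

scale-distribʳ : ∀ a b q → scale (a ℤ.+ b) q ≡ scale a q ⊕ scale b q
scale-distribʳ a b []      = refl
scale-distribʳ a b (c ∷ q) = cong₂ _∷_ (ℤₚ.*-distribʳ-+ c a b) (scale-distribʳ a b q)

scale-assoc : ∀ a b q → scale (a ℤ.* b) q ≡ scale a (scale b q)
scale-assoc a b []      = refl
scale-assoc a b (c ∷ q) = cong₂ _∷_ (ℤₚ.*-assoc a b c) (scale-assoc a b q)

scale-comm : ∀ a b q → scale a (scale b q) ≡ scale b (scale a q)
scale-comm a b q = begin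
  scale a (scale b q)  ≡⟨ scale-assoc a b q ⟨
  scale (a ℤ.* b) q    ≡⟨ cong (λ x → scale x q) (ℤₚ.*-comm a b) ⟩
  scale (b ℤ.* a) q    ≡⟨ scale-assoc b a q ⟩
  scale b (scale a q)  ∎
  where open ≡-Reasoning

scale-identity : ∀ q → scale (+ 1) q ≡ q
scale-identity []      = refl
scale-identity (a ∷ q) = cong₂ _∷_ (ℤₚ.*-identityˡ a) (scale-identity q)

scale-zero : ∀ q → scale (+ 0) q ≈ []
scale-zero []      = ≈-refl
scale-zero (a ∷ q) = ∷-≈[] refl (scale-zero q)

scale-∷-zero : ∀ a q → scale a (+ 0 ∷ q) ≡ + 0 ∷ scale a q
scale-∷-zero a q = cong (_∷ scale a q) (ℤₚ.*-zeroʳ a)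

scale-⊗-step : ∀ a q r → scale a q ⊕ (+ 0 ∷ scale a r) ≡ scale a (q ⊕ (+ 0 ∷ r))
scale-⊗-step a q r = begin
  scale a q ⊕ (+ 0 ∷ scale a r)      ≡⟨ cong (scale a q ⊕_) (scale-∷-zero a r) ⟨
  scale a q ⊕ scale a (+ 0 ∷ r)      ≡⟨ scale-distribˡ a q (+ 0 ∷ r) ⟨
  scale a (q ⊕ (+ 0 ∷ r))            ∎
  where open ≡-Reasoning

⊗-zeroʳ : ∀ q → q ⊗ [] ≈ []
⊗-zeroʳ []      = ≈-refl
⊗-zeroʳ (a ∷ q) = ∷-≈[] refl (⊗-zeroʳ q)

zero-∷-⊗ : ∀ q r → (+ 0 ∷ q) ⊗ r ≈ + 0 ∷ q ⊗ r
zero-∷-⊗ q r = ⊕-congˡ (+ 0 ∷ q ⊗ r) (scale-zero r)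

⊗-zero-∷ : ∀ q r → q ⊗ (+ 0 ∷ r) ≈ + 0 ∷ q ⊗ r
⊗-zero-∷ []      r = ≈-sym (∷-≈[] refl ≈-refl)
⊗-zero-∷ (a ∷ q) r = begin
  scale a (+ 0 ∷ r) ⊕ (+ 0 ∷ q ⊗ (+ 0 ∷ r))  ≡⟨ cong (_⊕ (+ 0 ∷ q ⊗ (+ 0 ∷ r))) (scale-∷-zero a r) ⟩
  (+ 0 ∷ scale a r) ⊕ (+ 0 ∷ q ⊗ (+ 0 ∷ r))  ≈⟨ ⊕-congʳ (+ 0 ∷ scale a r) (∷-congʳ {a = + 0} (⊗-zero-∷ q r)) ⟩
  + 0 ∷ (scale a r ⊕ (+ 0 ∷ q ⊗ r))          ∎
  where open ≈-Reasoning

⊗-identityˡ : ∀ q → one ⊗ q ≈ q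
⊗-identityˡ q = begin
  scale (+ 1) q ⊕ (+ 0 ∷ [])  ≡⟨ cong (_⊕ _) (scale-identity q) ⟩
  q ⊕ (+ 0 ∷ [])              ≈⟨ ⊕-congʳ q (∷-≈[] refl ≈-refl) ⟩
  q ⊕ []                      ≡⟨ ⊕-identityʳ q ⟩
  q                           ∎
  where open ≈-Reasoning

⊗-identityʳ : ∀ q → q ⊗ one ≈ q
⊗-identityʳ []      = ≈-refl
⊗-identityʳ (a ∷ q) = ∷-cong (trans (ℤₚ.+-identityʳ _) (ℤₚ.*-identityʳ a)) (⊗-identityʳ q)

⊗-congʳ : ∀ q → r ≈ r′ → q ⊗ r ≈ q ⊗ r′
⊗-congʳ []      r≈r′ = ≈-refl
⊗-congʳ (a ∷ q) r≈r′ = ⊕-cong (scale-cong r≈r′) (∷-congʳ (⊗-congʳ q r≈r′))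

≈[]-⊗ : q ≈ [] → q ⊗ r ≈ []
≈[]-⊗ {[]}    q≈[] = ≈-refl
≈[]-⊗ {a ∷ q} {r} a∷q≈[] = begin
  scale a r ⊕ (+ 0 ∷ q ⊗ r)      ≡⟨ cong (λ x → scale x r ⊕ _) (∷-≈[]-head a∷q≈[]) ⟩
  scale (+ 0) r ⊕ (+ 0 ∷ q ⊗ r)  ≈⟨ ⊕-cong (scale-zero r) (∷-≈[] refl (≈[]-⊗ (∷-≈[]-tail a∷q≈[]))) ⟩
  []                             ∎
  where open ≈-Reasoning

⊗-congˡ : q ≈ q′ → q ⊗ r ≈ q′ ⊗ r
⊗-congˡ {[]}    {q′}      q≈q′ = ≈-sym (≈[]-⊗ (≈-sym q≈q′))
⊗-congˡ {a ∷ q} {[]}      q≈q′ = ≈[]-⊗ q≈q′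
⊗-congˡ {a ∷ q} {b ∷ q′} {r} q≈q′ =
  ⊕-cong (≡⇒≈ (cong (λ x → scale x r) (coeff-≡ q≈q′ 0)))
         (∷-congʳ (⊗-congˡ (∷-≈-∷-tail q≈q′)))

⊗-distribʳ : ∀ q q′ r → (q ⊕ q′) ⊗ r ≈ (q ⊗ r) ⊕ (q′ ⊗ r)
⊗-distribʳ []      q′       r = ≈-refl
⊗-distribʳ (a ∷ q) []       r = ≡⇒≈ (sym (⊕-identityʳ _))
⊗-distribʳ (a ∷ q) (b ∷ q′) r = begin
  scale (a ℤ.+ b) r ⊕ (+ 0 ∷ (q ⊕ q′) ⊗ r)
    ≈⟨ ⊕-cong (≡⇒≈ (scale-distribʳ a b r)) (∷-congʳ (⊗-distribʳ q q′ r)) ⟩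
  (scale a r ⊕ scale b r) ⊕ ((+ 0 ∷ q ⊗ r) ⊕ (+ 0 ∷ q′ ⊗ r))
    ≈⟨ ⊕-interchange (scale a r) (scale b r) (+ 0 ∷ q ⊗ r) (+ 0 ∷ q′ ⊗ r) ⟩
  ((a ∷ q) ⊗ r) ⊕ ((b ∷ q′) ⊗ r)
    ∎
  where open ≈-Reasoning

⊗-distribˡ : ∀ q r r′ → q ⊗ (r ⊕ r′) ≈ (q ⊗ r) ⊕ (q ⊗ r′)
⊗-distribˡ []      r r′ = ≈-refl
⊗-distribˡ (a ∷ q) r r′ = begin
  scale a (r ⊕ r′) ⊕ (+ 0 ∷ q ⊗ (r ⊕ r′))
    ≈⟨ ⊕-cong (≡⇒≈ (scale-distribˡ a r r′)) (∷-congʳ (⊗-distribˡ q r r′)) ⟩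
  (scale a r ⊕ scale a r′) ⊕ ((+ 0 ∷ q ⊗ r) ⊕ (+ 0 ∷ q ⊗ r′))
    ≈⟨ ⊕-interchange (scale a r) (scale a r′) (+ 0 ∷ q ⊗ r) (+ 0 ∷ q ⊗ r′) ⟩
  ((a ∷ q) ⊗ r) ⊕ ((a ∷ q) ⊗ r′)
    ∎
  where open ≈-Reasoning

scale-⊗ : ∀ a q r → scale a q ⊗ r ≈ scale a (q ⊗ r)
scale-⊗ a []      r = ≈-refl
scale-⊗ a (b ∷ q) r = begin
  scale (a ℤ.* b) r ⊕ (+ 0 ∷ scale a q ⊗ r)
    ≈⟨ ⊕-cong (≡⇒≈ (scale-assoc a b r)) (∷-congʳ (scale-⊗ a q r)) ⟩
  scale a (scale b r) ⊕ (+ 0 ∷ scale a (q ⊗ r))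
    ≡⟨ scale-⊗-step a (scale b r) (q ⊗ r) ⟩
  scale a ((b ∷ q) ⊗ r)
    ∎
  where open ≈-Reasoning

⊗-scale : ∀ q a r → q ⊗ scale a r ≈ scale a (q ⊗ r)
⊗-scale []      a r = ≈-refl
⊗-scale (b ∷ q) a r = begin
  scale b (scale a r) ⊕ (+ 0 ∷ q ⊗ scale a r)
    ≈⟨ ⊕-cong (≡⇒≈ (scale-comm b a r)) (∷-congʳ (⊗-scale q a r)) ⟩
  scale a (scale b r) ⊕ (+ 0 ∷ scale a (q ⊗ r))
    ≡⟨ scale-⊗-step a (scale b r) (q ⊗ r) ⟩
  scale a ((b ∷ q) ⊗ r)
    ∎
  where open ≈-Reasoning

⊗-assoc : ∀ q r s → (q ⊗ r) ⊗ s ≈ q ⊗ (r ⊗ s)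
⊗-assoc []      r s = ≈-refl
⊗-assoc (a ∷ q) r s = begin
  (scale a r ⊕ (+ 0 ∷ q ⊗ r)) ⊗ s      ≈⟨ ⊗-distribʳ (scale a r) (+ 0 ∷ q ⊗ r) s ⟩
  (scale a r ⊗ s) ⊕ ((+ 0 ∷ q ⊗ r) ⊗ s) ≈⟨ ⊕-cong (scale-⊗ a r s) (zero-∷-⊗ (q ⊗ r) s) ⟩
  scale a (r ⊗ s) ⊕ (+ 0 ∷ (q ⊗ r) ⊗ s) ≈⟨ ⊕-congʳ (scale a (r ⊗ s)) (∷-congʳ (⊗-assoc q r s)) ⟩
  scale a (r ⊗ s) ⊕ (+ 0 ∷ q ⊗ (r ⊗ s)) ∎
  where open ≈-Reasoning

length-⊕ : ∀ {m} q r → length q ≤ m → length r ≤ m → length (q ⊕ r) ≤ m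
length-⊕ []      r       _         r≤m       = r≤m
length-⊕ (a ∷ q) []      q≤m       _         = q≤m
length-⊕ (a ∷ q) (b ∷ r) (s≤s q≤m) (s≤s r≤m) = s≤s (length-⊕ q r q≤m r≤m)

length-scale : ∀ a q → length (scale a q) ≡ length q
length-scale a []      = refl
length-scale a (b ∷ q) = cong suc (length-scale a q)

length-⊗ : ∀ D E q r → length q ≤ suc D → length r ≤ suc E → length (q ⊗ r) ≤ suc (D + E)
length-⊗ D E []      r _         _     = z≤n
length-⊗ D E (a ∷ q) r (s≤s q≤D) r≤1+E = length-⊕ (scale a r) (+ 0 ∷ q ⊗ r)
  (subst (_≤ suc (D + E)) (sym (length-scale a r)) (ℕₚ.≤-trans r≤1+E (s≤s (ℕₚ.m≤n+m E D))))
  (s≤s (⊗-pred D q q≤D))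
  where
  ⊗-pred : ∀ F s → length s ≤ F → length (s ⊗ r) ≤ F + E
  ⊗-pred F       []      _       = z≤n
  ⊗-pred zero    (b ∷ s) ()
  ⊗-pred (suc F) (b ∷ s) b∷s≤1+F = length-⊗ F E (b ∷ s) r b∷s≤1+F r≤1+E

[A+1]²-2A≈A²+1 : ∀ A → ((A ⊕ one) ⊗ (A ⊕ one)) ⊕ scale (- + 2) A ≈ (A ⊗ A) ⊕ one
[A+1]²-2A≈A²+1 A = ≈-trans (⊕-congˡ (scale (- + 2) A) expand) (coeffwise collect)
  where
  expand : (A ⊕ one) ⊗ (A ⊕ one) ≈ ((A ⊗ A) ⊕ A) ⊕ (A ⊕ one)
  expand = begin
    (A ⊕ one) ⊗ (A ⊕ one)                        ≈⟨ ⊗-distribʳ A one (A ⊕ one) ⟩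
    (A ⊗ (A ⊕ one)) ⊕ (one ⊗ (A ⊕ one))          ≈⟨ ⊕-cong (⊗-distribˡ A A one) (⊗-identityˡ (A ⊕ one)) ⟩
    ((A ⊗ A) ⊕ (A ⊗ one)) ⊕ (A ⊕ one)            ≈⟨ ⊕-congˡ (A ⊕ one) (⊕-congʳ (A ⊗ A) (⊗-identityʳ A)) ⟩
    ((A ⊗ A) ⊕ A) ⊕ (A ⊕ one)                    ∎
    where open ≈-Reasoning
  identity : ∀ x y z → ((x ℤ.+ y) ℤ.+ (y ℤ.+ z)) ℤ.+ (- + 2) ℤ.* y ≡ x ℤ.+ z
  identity = solve-∀
  collect : ∀ k → coeff ((((A ⊗ A) ⊕ A) ⊕ (A ⊕ one)) ⊕ scale (- + 2) A) k ≡ coeff ((A ⊗ A) ⊕ one) k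
  collect k = begin
    coeff ((((A ⊗ A) ⊕ A) ⊕ (A ⊕ one)) ⊕ scale (- + 2) A) k
      ≡⟨ coeff-⊕ (((A ⊗ A) ⊕ A) ⊕ (A ⊕ one)) (scale (- + 2) A) k ⟩
    coeff (((A ⊗ A) ⊕ A) ⊕ (A ⊕ one)) k ℤ.+ coeff (scale (- + 2) A) k
      ≡⟨ cong₂ ℤ._+_ (trans (coeff-⊕ ((A ⊗ A) ⊕ A) (A ⊕ one) k)
                            (cong₂ ℤ._+_ (coeff-⊕ (A ⊗ A) A k) (coeff-⊕ A one k)))
                     (coeff-scale (- + 2) A k) ⟩
    ((x ℤ.+ y) ℤ.+ (y ℤ.+ z)) ℤ.+ (- + 2) ℤ.* y
      ≡⟨ identity x y z ⟩
    x ℤ.+ z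
      ≡⟨ coeff-⊕ (A ⊗ A) one k ⟨
    coeff ((A ⊗ A) ⊕ one) k
      ∎
    where
    open ≡-Reasoning
    x y z : ℤ
    x = coeff (A ⊗ A) k
    y = coeff A k
    z = coeff one k

shift : ℕ → Poly → Poly
shift zero    q = q
shift (suc d) q = + 0 ∷ shift d q

infix 25 t^_
t^_ : ℕ → Poly
t^ d = shift d one

shift-cong : ∀ d → q ≈ r → shift d q ≈ shift d r
shift-cong zero    q≈r = q≈r
shift-cong (suc d) q≈r = ∷-congʳ (shift-cong d q≈r)

shift-+ : ∀ d e q → shift (d + e) q ≡ shift d (shift e q)
shift-+ zero    e q = refl
shift-+ (suc d) e q = cong (+ 0 ∷_) (shift-+ d e q)

shift-⊗ : ∀ d q r → shift d q ⊗ r ≈ shift d (q ⊗ r)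
shift-⊗ zero    q r = ≈-refl
shift-⊗ (suc d) q r = ≈-trans (zero-∷-⊗ (shift d q) r) (∷-congʳ (shift-⊗ d q r))

⊗-shift : ∀ d q r → q ⊗ shift d r ≈ shift d (q ⊗ r)
⊗-shift zero    q r = ≈-refl
⊗-shift (suc d) q r = ≈-trans (⊗-zero-∷ q (shift d r)) (∷-congʳ (⊗-shift d q r))

coeff-shift : ∀ d q m → coeff (shift d q) (d + m) ≡ coeff q m
coeff-shift zero    q m = refl
coeff-shift (suc d) q m = coeff-shift d q m

coeff-shift-< : ∀ {d e} q → e < d → coeff (shift d q) e ≡ + 0
coeff-shift-< {suc d} {zero}  q _         = refl
coeff-shift-< {suc d} {suc e} q (s≤s e<d) = coeff-shift-< q e<d

t^-⊗ : ∀ d q → t^ d ⊗ q ≈ shift d q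
t^-⊗ d q = ≈-trans (shift-⊗ d one q) (shift-cong d (⊗-identityˡ q))

t^-+ : ∀ d e → t^ (d + e) ≈ t^ d ⊗ t^ e
t^-+ d e = ≈-trans (≡⇒≈ (shift-+ d e one)) (≈-sym (t^-⊗ d (t^ e)))

t^-central : ∀ d q r → q ⊗ (t^ d ⊗ r) ≈ t^ d ⊗ (q ⊗ r)
t^-central d q r = begin
  q ⊗ (t^ d ⊗ r)   ≈⟨ ⊗-congʳ q (t^-⊗ d r) ⟩
  q ⊗ shift d r    ≈⟨ ⊗-shift d q r ⟩
  shift d (q ⊗ r)  ≈⟨ t^-⊗ d (q ⊗ r) ⟨
  t^ d ⊗ (q ⊗ r)   ∎
  where open ≈-Reasoning

1+t² : Poly
1+t² = + 1 ∷ + 0 ∷ + 1 ∷ []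

1+t²-⊗ : ∀ q → 1+t² ⊗ q ≈ q ⊕ shift 2 q
1+t²-⊗ q = ⊕-cong (≡⇒≈ (scale-identity q))
                  (∷-congʳ (≈-trans (zero-∷-⊗ one q) (∷-congʳ (⊗-identityˡ q))))

infixr 30 _⊗^_
_⊗^_ : Poly → ℕ → Poly
q ⊗^ zero  = one
q ⊗^ suc k = q ⊗ (q ⊗^ k)

-- joukowski D q = t^D · q(t + t⁻¹) (x = t + t⁻¹ is the Joukowski map), computed by Horner's rule
-- t^D (a + x q′(x)) = a t^D + (1 + t²) · t^(D-1) q′(x). This is meaningful only when deg q ≤ D;
-- otherwise the truncated D ∸ 1 makes the value junk.
joukowski : ℕ → Poly → Poly
joukowski D []      = []
joukowski D (a ∷ q) = scale a (t^ D) ⊕ (1+t² ⊗ joukowski (D ∸ 1) q)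

joukowski-⊕ : ∀ D q r → joukowski D (q ⊕ r) ≈ joukowski D q ⊕ joukowski D r
joukowski-⊕ D []      r       = ≈-refl
joukowski-⊕ D (a ∷ q) []      = ≡⇒≈ (sym (⊕-identityʳ _))
joukowski-⊕ D (a ∷ q) (b ∷ r) = begin
  scale (a ℤ.+ b) (t^ D) ⊕ (1+t² ⊗ joukowski (D ∸ 1) (q ⊕ r))
    ≈⟨ ⊕-cong (≡⇒≈ (scale-distribʳ a b (t^ D)))
              (≈-trans (⊗-congʳ 1+t² (joukowski-⊕ (D ∸ 1) q r)) (⊗-distribˡ 1+t² Jq Jr)) ⟩
  (scale a (t^ D) ⊕ scale b (t^ D)) ⊕ ((1+t² ⊗ Jq) ⊕ (1+t² ⊗ Jr))
    ≈⟨ ⊕-interchange (scale a (t^ D)) (scale b (t^ D)) (1+t² ⊗ Jq) (1+t² ⊗ Jr) ⟩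
  joukowski D (a ∷ q) ⊕ joukowski D (b ∷ r)
    ∎
  where
  open ≈-Reasoning
  Jq Jr : Poly
  Jq = joukowski (D ∸ 1) q
  Jr = joukowski (D ∸ 1) r

joukowski-scale : ∀ D a q → joukowski D (scale a q) ≈ scale a (joukowski D q)
joukowski-scale D a []      = ≈-refl
joukowski-scale D a (b ∷ q) = begin
  scale (a ℤ.* b) (t^ D) ⊕ (1+t² ⊗ joukowski (D ∸ 1) (scale a q))
    ≈⟨ ⊕-cong (≡⇒≈ (scale-assoc a b (t^ D)))
              (≈-trans (⊗-congʳ 1+t² (joukowski-scale (D ∸ 1) a q)) (⊗-scale 1+t² a Jq)) ⟩
  scale a (scale b (t^ D)) ⊕ scale a (1+t² ⊗ Jq)
    ≡⟨ scale-distribˡ a (scale b (t^ D)) (1+t² ⊗ Jq) ⟨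
  scale a (joukowski D (b ∷ q))
    ∎
  where
  open ≈-Reasoning
  Jq : Poly
  Jq = joukowski (D ∸ 1) q

joukowski-zero-∷ : ∀ D q → joukowski D (+ 0 ∷ q) ≈ 1+t² ⊗ joukowski (D ∸ 1) q
joukowski-zero-∷ D q = ⊕-congˡ (1+t² ⊗ joukowski (D ∸ 1) q) (scale-zero (t^ D))

joukowski-constant : ∀ D a → joukowski D (a ∷ []) ≈ scale a (t^ D)
joukowski-constant D a = ≈-trans (⊕-congʳ (scale a (t^ D)) (⊗-zeroʳ 1+t²))
                                 (≡⇒≈ (⊕-identityʳ (scale a (t^ D))))

joukowski-pad : ∀ D E r → length r ≤ suc E → joukowski (D + E) r ≈ t^ D ⊗ joukowski E r
joukowski-pad D E []      _           = ≈-sym (⊗-zeroʳ (t^ D))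
joukowski-pad D E (b ∷ r) (s≤s r≤E) = begin
  scale b (t^ (D + E)) ⊕ (1+t² ⊗ joukowski (D + E ∸ 1) r)
    ≈⟨ ⊕-cong (scale-cong (t^-+ D E)) (⊗-congʳ 1+t² (pad-pred E r r≤E)) ⟩
  scale b (t^ D ⊗ t^ E) ⊕ (1+t² ⊗ (t^ D ⊗ Jr))
    ≈⟨ ⊕-cong (≈-sym (⊗-scale (t^ D) b (t^ E))) (t^-central D 1+t² Jr) ⟩
  (t^ D ⊗ scale b (t^ E)) ⊕ (t^ D ⊗ (1+t² ⊗ Jr))
    ≈⟨ ⊗-distribˡ (t^ D) (scale b (t^ E)) (1+t² ⊗ Jr) ⟨
  t^ D ⊗ joukowski E (b ∷ r)
    ∎
  where
  open ≈-Reasoning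
  Jr : Poly
  Jr = joukowski (E ∸ 1) r
  pad-pred : ∀ F s → length s ≤ F → joukowski (D + F ∸ 1) s ≈ t^ D ⊗ joukowski (F ∸ 1) s
  pad-pred F       []      _ = ≈-sym (⊗-zeroʳ (t^ D))
  pad-pred zero    (c ∷ s) ()
  pad-pred (suc F) (c ∷ s) c∷s≤1+F rewrite ℕₚ.+-suc D F = joukowski-pad D F (c ∷ s) c∷s≤1+F

joukowski-⊗ : ∀ D E q r → length q ≤ suc D → length r ≤ suc E →
              joukowski (D + E) (q ⊗ r) ≈ joukowski D q ⊗ joukowski E r
joukowski-⊗ D E []      r _           _     = ≈-refl
joukowski-⊗ D E (a ∷ q) r (s≤s q≤D) r≤1+E = begin
  joukowski (D + E) (scale a r ⊕ (+ 0 ∷ q ⊗ r))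
    ≈⟨ joukowski-⊕ (D + E) (scale a r) (+ 0 ∷ q ⊗ r) ⟩
  joukowski (D + E) (scale a r) ⊕ joukowski (D + E) (+ 0 ∷ q ⊗ r)
    ≈⟨ ⊕-cong (joukowski-scale (D + E) a r) (joukowski-zero-∷ (D + E) (q ⊗ r)) ⟩
  scale a (joukowski (D + E) r) ⊕ (1+t² ⊗ joukowski (D + E ∸ 1) (q ⊗ r))
    ≈⟨ ⊕-cong (scale-cong (joukowski-pad D E r r≤1+E)) (⊗-congʳ 1+t² (⊗-pred D q q≤D)) ⟩
  scale a (t^ D ⊗ Jr) ⊕ (1+t² ⊗ (Jq ⊗ Jr))
    ≈⟨ ⊕-cong (≈-sym (scale-⊗ a (t^ D) Jr)) (≈-sym (⊗-assoc 1+t² Jq Jr)) ⟩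
  (scale a (t^ D) ⊗ Jr) ⊕ ((1+t² ⊗ Jq) ⊗ Jr)
    ≈⟨ ⊗-distribʳ (scale a (t^ D)) (1+t² ⊗ Jq) Jr ⟨
  joukowski D (a ∷ q) ⊗ Jr
    ∎
  where
  open ≈-Reasoning
  Jq Jr : Poly
  Jq = joukowski (D ∸ 1) q
  Jr = joukowski E r
  ⊗-pred : ∀ F s → length s ≤ F → joukowski (F + E ∸ 1) (s ⊗ r) ≈ joukowski (F ∸ 1) s ⊗ Jr
  ⊗-pred F       []      _       = ≈-refl
  ⊗-pred zero    (b ∷ s) ()
  ⊗-pred (suc F) (b ∷ s) b∷s≤1+F = joukowski-⊗ F E (b ∷ s) r b∷s≤1+F r≤1+E

-- Dickson polynomials: q(t + t⁻¹) = t^D + t^(-D).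
record Dickson (D : ℕ) (q : Poly) : Set where
  constructor dickson
  field
    length≤ : length q ≤ suc D
    joukowski≈ : joukowski D q ≈ t^ (D + D) ⊕ one

dickson-p₀ : Dickson 2 (p 0)
dickson-p₀ = dickson (s≤s (s≤s (s≤s z≤n))) (coeffwise λ
  { 0 → refl ; 1 → refl ; 2 → refl ; 3 → refl ; 4 → refl ; 5 → refl ; 6 → refl
  ; (suc (suc (suc (suc (suc (suc (suc k))))))) → refl })

dickson-sqMinus2 : ∀ {D q} → Dickson D q → Dickson (D + D) (sqMinus2 q)
dickson-sqMinus2 {D} {q} (dickson q≤1+D q-dickson) =
  dickson (length-⊕ (q ⊗ q) (- + 2 ∷ []) (length-⊗ D D q q q≤1+D q≤1+D) (s≤s z≤n)) (begin
  joukowski (D + D) ((q ⊗ q) ⊕ (- + 2 ∷ []))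
    ≈⟨ joukowski-⊕ (D + D) (q ⊗ q) (- + 2 ∷ []) ⟩
  joukowski (D + D) (q ⊗ q) ⊕ joukowski (D + D) (- + 2 ∷ [])
    ≈⟨ ⊕-cong (joukowski-⊗ D D q q q≤1+D q≤1+D) (joukowski-constant (D + D) (- + 2)) ⟩
  (joukowski D q ⊗ joukowski D q) ⊕ scale (- + 2) A
    ≈⟨ ⊕-congˡ (scale (- + 2) A) (≈-trans (⊗-congˡ q-dickson) (⊗-congʳ (A ⊕ one) q-dickson)) ⟩
  ((A ⊕ one) ⊗ (A ⊕ one)) ⊕ scale (- + 2) A
    ≈⟨ [A+1]²-2A≈A²+1 A ⟩
  (A ⊗ A) ⊕ one
    ≈⟨ ⊕-congˡ one (t^-+ (D + D) (D + D)) ⟨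
  t^ ((D + D) + (D + D)) ⊕ one
    ∎)
  where
  open ≈-Reasoning
  A : Poly
  A = t^ (D + D)

dickson-p : ∀ n → Dickson (2 ^ suc n) (p n)
dickson-p zero    = dickson-p₀
dickson-p (suc n) = subst (λ D → Dickson D (p (suc n))) (sym 2^[2+n]≡2^[1+n]+2^[1+n])
                          (dickson-sqMinus2 (dickson-p n))
  where
  2^[2+n]≡2^[1+n]+2^[1+n] : 2 ^ suc (suc n) ≡ 2 ^ suc n + 2 ^ suc n
  2^[2+n]≡2^[1+n]+2^[1+n] = cong (λ x → 2 ^ suc n + x) (ℕₚ.+-identityʳ (2 ^ suc n))

sum< : ℕ → (ℕ → ℤ) → ℤ
sum< zero    f = + 0
sum< (suc m) f = f 0 ℤ.+ sum< m (λ i → f (suc i))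

sum<-cong : ∀ m {f g} → (∀ i → i < m → f i ≡ g i) → sum< m f ≡ sum< m g
sum<-cong zero    f≡g = refl
sum<-cong (suc m) f≡g = cong₂ ℤ._+_ (f≡g 0 (s≤s z≤n)) (sum<-cong m λ i i<m → f≡g (suc i) (s≤s i<m))

sum<-zero : ∀ m {f} → (∀ i → i < m → f i ≡ + 0) → sum< m f ≡ + 0
sum<-zero zero    f≡0 = refl
sum<-zero (suc m) f≡0 = cong₂ ℤ._+_ (f≡0 0 (s≤s z≤n)) (sum<-zero m λ i i<m → f≡0 (suc i) (s≤s i<m))

sum<-last : ∀ m f → sum< (suc m) f ≡ sum< m f ℤ.+ f m
sum<-last zero    f = trans (ℤₚ.+-identityʳ (f 0)) (sym (ℤₚ.+-identityˡ (f 0)))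
sum<-last (suc m) f = trans (cong (λ s → f 0 ℤ.+ s) (sum<-last m (λ i → f (suc i))))
                            (sym (ℤₚ.+-assoc (f 0) _ (f (suc m))))

sum<-+ : ∀ m n f → sum< (m + n) f ≡ sum< m f ℤ.+ sum< n (λ i → f (m + i))
sum<-+ zero    n f = sym (ℤₚ.+-identityˡ _)
sum<-+ (suc m) n f = trans (cong (λ s → f 0 ℤ.+ s) (sum<-+ m n (λ i → f (suc i))))
                           (sym (ℤₚ.+-assoc (f 0) _ _))

sum<-even-odd : ∀ M f →
  sum< (suc (2 * M)) f ≡ sum< (suc M) (λ i → f (2 * i)) ℤ.+ sum< M (λ i → f (suc (2 * i)))
sum<-even-odd zero    f = sym (ℤₚ.+-identityʳ _)
sum<-even-odd (suc M) f = begin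
  sum< (suc (2 * suc M)) f
    ≡⟨ cong (λ m → sum< (suc m) f) (ℕₚ.*-suc 2 M) ⟩
  f 0 ℤ.+ (f 1 ℤ.+ sum< (suc (2 * M)) (λ i → f (suc (suc i))))
    ≡⟨ cong (λ s → f 0 ℤ.+ (f 1 ℤ.+ s)) (sum<-even-odd M (λ i → f (suc (suc i)))) ⟩
  f 0 ℤ.+ (f 1 ℤ.+ (evens ℤ.+ odds))
    ≡⟨ regroup (f 0) (f 1) evens odds ⟩
  (f 0 ℤ.+ evens) ℤ.+ (f 1 ℤ.+ odds)
    ≡⟨ cong₂ (λ e o → (f 0 ℤ.+ e) ℤ.+ (f 1 ℤ.+ o))
             (sum<-cong (suc M) λ i _ → cong f (sym (ℕₚ.*-suc 2 i)))
             (sum<-cong M λ i _ → cong (λ m → f (suc m)) (sym (ℕₚ.*-suc 2 i))) ⟩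
  sum< (suc (suc M)) (λ i → f (2 * i)) ℤ.+ sum< (suc M) (λ i → f (suc (2 * i)))
    ∎
  where
  open ≡-Reasoning
  evens odds : ℤ
  evens = sum< (suc M) (λ i → f (suc (suc (2 * i))))
  odds  = sum< M (λ i → f (suc (suc (suc (2 * i)))))
  regroup : ∀ w x y z → w ℤ.+ (x ℤ.+ (y ℤ.+ z)) ≡ (w ℤ.+ y) ℤ.+ (x ℤ.+ z)
  regroup = solve-∀

sum<-unique : ∀ f (g : ℕ → ℤ) → g 0 ≡ + 0 → (∀ m → g (suc m) ≡ f m ℤ.+ g m) → ∀ m → g m ≡ sum< m f
sum<-unique f g g0≡0 g-step zero    = g0≡0
sum<-unique f g g0≡0 g-step (suc m) = begin
  g (suc m)          ≡⟨ g-step m ⟩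
  f m ℤ.+ g m        ≡⟨ cong (λ s → f m ℤ.+ s) (sum<-unique f g g0≡0 g-step m) ⟩
  f m ℤ.+ sum< m f   ≡⟨ ℤₚ.+-comm (f m) (sum< m f) ⟩
  sum< m f ℤ.+ f m   ≡⟨ sum<-last m f ⟨
  sum< (suc m) f     ∎
  where open ≡-Reasoning

-- sumFromTo counts down through a local function we cannot name; abstracting its count
-- lets unification instantiate g in sum<-unique with that function.
sumFromTo-sum< : ∀ a b f → sumFromTo a b f ≡ sum< (suc b ∸ a) (λ i → f (a + i))
sumFromTo-sum< a b f with sum<-unique (λ i → f (a + i)) _ refl (λ _ → refl) | suc b ∸ a
... | g≡sum | count = g≡sum count

sumFromTo-shift : ∀ a j f → sumFromTo (a + 1) (a + j) f ≡ sum< j (λ x → f (a + suc x))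
sumFromTo-shift a j f = begin
  sumFromTo (a + 1) (a + j) f                         ≡⟨ sumFromTo-sum< (a + 1) (a + j) f ⟩
  sum< (suc (a + j) ∸ (a + 1)) (λ x → f (a + 1 + x))  ≡⟨ cong (λ m → sum< m _) count≡j ⟩
  sum< j (λ x → f (a + 1 + x))                        ≡⟨ sum<-cong j (λ x _ → cong f (ℕₚ.+-assoc a 1 x)) ⟩
  sum< j (λ x → f (a + suc x))                        ∎
  where
  open ≡-Reasoning
  count≡j : suc (a + j) ∸ (a + 1) ≡ j
  count≡j = trans (cong (suc (a + j) ∸_) (ℕₚ.+-comm a 1)) (ℕₚ.m+n∸m≡n a j)

lincomb : Poly → (ℕ → Poly) → Poly
lincomb []      w = []
lincomb (a ∷ q) w = scale a (w 0) ⊕ lincomb q (λ k → w (suc k))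

⊗-lincomb : ∀ r q w → r ⊗ lincomb q w ≈ lincomb q (λ k → r ⊗ w k)
⊗-lincomb r []      w = ⊗-zeroʳ r
⊗-lincomb r (a ∷ q) w = ≈-trans (⊗-distribˡ r (scale a (w 0)) (lincomb q (λ k → w (suc k))))
                                (⊕-cong (⊗-scale r a (w 0)) (⊗-lincomb r q (λ k → w (suc k))))

coeff-lincomb : ∀ q w e {L} → length q ≤ L →
                coeff (lincomb q w) e ≡ sum< L (λ k → coeff q k ℤ.* coeff (w k) e)
coeff-lincomb []      w e {L}     _         = sym (sum<-zero L λ _ _ → refl)
coeff-lincomb (a ∷ q) w e {suc L} (s≤s q≤L) =
  trans (coeff-⊕ (scale a (w 0)) (lincomb q (λ k → w (suc k))) e)
        (cong₂ ℤ._+_ (coeff-scale a (w 0) e) (coeff-lincomb q (λ k → w (suc k)) e q≤L))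

-- The image t^(D-k) (1+t²)^k of x^k under joukowski D.
joukowski-basis : ℕ → ℕ → Poly
joukowski-basis D zero    = t^ D
joukowski-basis D (suc k) = 1+t² ⊗ joukowski-basis (D ∸ 1) k

joukowski-lincomb : ∀ D q → joukowski D q ≈ lincomb q (joukowski-basis D)
joukowski-lincomb D []      = ≈-refl
joukowski-lincomb D (a ∷ q) = ⊕-congʳ (scale a (t^ D))
  (≈-trans (⊗-congʳ 1+t² (joukowski-lincomb (D ∸ 1) q)) (⊗-lincomb 1+t² q (joukowski-basis (D ∸ 1))))

coeff-joukowski : ∀ D q e {L} → length q ≤ L →
  coeff (joukowski D q) e ≡ sum< L (λ k → coeff q k ℤ.* coeff (joukowski-basis D k) e)
coeff-joukowski D q e q≤L = trans (coeff-≡ (joukowski-lincomb D q) e) (coeff-lincomb q _ e q≤L)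

joukowski-basis-closed : ∀ k d → joukowski-basis (k + d) k ≈ shift d (1+t² ⊗^ k)
joukowski-basis-closed zero    d = ≈-refl
joukowski-basis-closed (suc k) d = ≈-trans (⊗-congʳ 1+t² (joukowski-basis-closed k d))
                                           (⊗-shift d 1+t² (1+t² ⊗^ k))

coeff-1+t²-⊗ : ∀ q e → coeff (1+t² ⊗ q) e ≡ coeff q e ℤ.+ coeff (shift 2 q) e
coeff-1+t²-⊗ q e = trans (coeff-≡ (1+t²-⊗ q) e) (coeff-⊕ q (shift 2 q) e)

coeff-1+t²^-odd : ∀ k i → coeff (1+t² ⊗^ k) (suc (2 * i)) ≡ + 0
coeff-1+t²^-odd zero    i       = refl
coeff-1+t²^-odd (suc k) zero    = trans (coeff-1+t²-⊗ (1+t² ⊗^ k) 1)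
                                        (cong (ℤ._+ + 0) (coeff-1+t²^-odd k 0))
coeff-1+t²^-odd (suc k) (suc i) = begin
  coeff (1+t² ⊗^ suc k) (suc (2 * suc i))
    ≡⟨ coeff-1+t²-⊗ (1+t² ⊗^ k) (suc (2 * suc i)) ⟩
  coeff (1+t² ⊗^ k) (suc (2 * suc i)) ℤ.+ coeff (shift 2 (1+t² ⊗^ k)) (suc (2 * suc i))
    ≡⟨ cong₂ ℤ._+_ (coeff-1+t²^-odd k (suc i))
                   (cong (λ m → coeff (shift 2 (1+t² ⊗^ k)) (suc m)) (ℕₚ.*-suc 2 i)) ⟩
  + 0 ℤ.+ coeff (1+t² ⊗^ k) (suc (2 * i))
    ≡⟨ cong (λ x → + 0 ℤ.+ x) (coeff-1+t²^-odd k i) ⟩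
  + 0
    ∎
  where open ≡-Reasoning

coeff-1+t²^-even : ∀ k i → coeff (1+t² ⊗^ k) (2 * i) ≡ + (k C i)
coeff-1+t²^-even zero    zero    = refl
coeff-1+t²^-even zero    (suc i) = refl
coeff-1+t²^-even (suc k) zero    = trans (coeff-1+t²-⊗ (1+t² ⊗^ k) 0)
                                         (cong (ℤ._+ + 0) (coeff-1+t²^-even k 0))
coeff-1+t²^-even (suc k) (suc i) = begin
  coeff (1+t² ⊗^ suc k) (2 * suc i)
    ≡⟨ coeff-1+t²-⊗ (1+t² ⊗^ k) (2 * suc i) ⟩
  coeff (1+t² ⊗^ k) (2 * suc i) ℤ.+ coeff (shift 2 (1+t² ⊗^ k)) (2 * suc i)
    ≡⟨ cong₂ ℤ._+_ (coeff-1+t²^-even k (suc i))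
                   (cong (coeff (shift 2 (1+t² ⊗^ k))) (ℕₚ.*-suc 2 i)) ⟩
  + (k C suc i) ℤ.+ coeff (1+t² ⊗^ k) (2 * i)
    ≡⟨ cong (λ x → + (k C suc i) ℤ.+ x) (coeff-1+t²^-even k i) ⟩
  + (k C suc i) ℤ.+ + (k C i)
    ≡⟨ ℤₚ.pos-+ (k C suc i) (k C i) ⟨
  + (k C suc i + k C i)
    ≡⟨ cong +_ (trans (ℕₚ.+-comm (k C suc i) (k C i)) (nCk+nC[k+1]≡[n+1]C[k+1] k i)) ⟩
  + (suc k C suc i)
    ∎
  where open ≡-Reasoning

coeff-shift-odd-even : ∀ r j q → (∀ i → coeff q (suc (2 * i)) ≡ + 0) →
                       coeff (shift (suc (2 * r)) q) (2 * j) ≡ + 0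
coeff-shift-odd-even r       zero    q q-odd = refl
coeff-shift-odd-even zero    (suc j) q q-odd = trans (cong (coeff (+ 0 ∷ q)) (ℕₚ.*-suc 2 j)) (q-odd j)
coeff-shift-odd-even (suc r) (suc j) q q-odd =
  trans (cong₂ (λ d e → coeff (shift (suc d) q) e) (ℕₚ.*-suc 2 r) (ℕₚ.*-suc 2 j))
        (coeff-shift-odd-even r j q q-odd)

coeff-basis-odd : ∀ {M} m j → m < M → coeff (joukowski-basis (2 * M) (suc (2 * m))) (2 * j) ≡ + 0
coeff-basis-odd m j m<M with ℕₚ.m≤n⇒∃[o]m+o≡n m<M
... | o , refl = begin
  coeff (joukowski-basis (2 * (suc m + o)) k) (2 * j)
    ≡⟨ cong (λ D → coeff (joukowski-basis D k) (2 * j)) (split m o) ⟩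
  coeff (joukowski-basis (k + suc (2 * o)) k) (2 * j)
    ≡⟨ coeff-≡ (joukowski-basis-closed k (suc (2 * o))) (2 * j) ⟩
  coeff (shift (suc (2 * o)) (1+t² ⊗^ k)) (2 * j)
    ≡⟨ coeff-shift-odd-even o j (1+t² ⊗^ k) (coeff-1+t²^-odd k) ⟩
  + 0
    ∎
  where
  open ≡-Reasoning
  k : ℕ
  k = suc (2 * m)
  split : ∀ m o → 2 * (suc m + o) ≡ suc (2 * m) + suc (2 * o)
  split = ℕ-solve-∀

coeff-basis-low : ∀ {a} m j → m < a → coeff (joukowski-basis (2 * (a + j)) (2 * m)) (2 * j) ≡ + 0
coeff-basis-low m j m<a with ℕₚ.m≤n⇒∃[o]m+o≡n m<a
... | o , refl = begin
  coeff (joukowski-basis (2 * (suc m + o + j)) (2 * m)) (2 * j)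
    ≡⟨ cong (λ D → coeff (joukowski-basis D (2 * m)) (2 * j)) (split m o j) ⟩
  coeff (joukowski-basis (2 * m + 2 * suc (o + j)) (2 * m)) (2 * j)
    ≡⟨ coeff-≡ (joukowski-basis-closed (2 * m) (2 * suc (o + j))) (2 * j) ⟩
  coeff (shift (2 * suc (o + j)) (1+t² ⊗^ (2 * m))) (2 * j)
    ≡⟨ coeff-shift-< (1+t² ⊗^ (2 * m)) (ℕₚ.*-monoʳ-< 2 (s≤s (ℕₚ.m≤n+m j o))) ⟩
  + 0
    ∎
  where
  open ≡-Reasoning
  split : ∀ m o j → 2 * (suc m + o + j) ≡ 2 * m + 2 * suc (o + j)
  split = ℕ-solve-∀

coeff-basis-mid : ∀ a {x j} → x ≤ j →
  coeff (joukowski-basis (2 * (a + j)) (2 * (a + x))) (2 * j) ≡ + (2 * (a + x) C x)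
coeff-basis-mid a {x} x≤j with ℕₚ.m≤n⇒∃[o]m+o≡n x≤j
... | o , refl = begin
  coeff (joukowski-basis (2 * (a + (x + o))) k) (2 * (x + o))
    ≡⟨ cong₂ (λ D e → coeff (joukowski-basis D k) e) (split-degree a x o) (split-index x o) ⟩
  coeff (joukowski-basis (k + 2 * o) k) (2 * o + 2 * x)
    ≡⟨ coeff-≡ (joukowski-basis-closed k (2 * o)) (2 * o + 2 * x) ⟩
  coeff (shift (2 * o) (1+t² ⊗^ k)) (2 * o + 2 * x)
    ≡⟨ coeff-shift (2 * o) (1+t² ⊗^ k) (2 * x) ⟩
  coeff (1+t² ⊗^ k) (2 * x)
    ≡⟨ coeff-1+t²^-even k x ⟩
  + (k C x)
    ∎
  where
  open ≡-Reasoning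
  k : ℕ
  k = 2 * (a + x)
  split-degree : ∀ a x o → 2 * (a + (x + o)) ≡ 2 * (a + x) + 2 * o
  split-degree = ℕ-solve-∀
  split-index : ∀ x o → 2 * (x + o) ≡ 2 * o + 2 * x
  split-index = ℕ-solve-∀

coeff-joukowski-even : ∀ {M} a j q → a + j ≡ M → length q ≤ suc (2 * M) →
  coeff (joukowski (2 * M) q) (2 * j) ≡
    coeff q (2 * a) ℤ.+ sum< j (λ x → + (2 * (a + suc x) C suc x) ℤ.* coeff q (2 * (a + suc x)))
coeff-joukowski-even {M} a j q refl q≤1+2M = begin
  coeff (joukowski (2 * M) q) (2 * j)
    ≡⟨ coeff-joukowski (2 * M) q (2 * j) q≤1+2M ⟩
  sum< (suc (2 * M)) F
    ≡⟨ sum<-even-odd M F ⟩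
  sum< (suc M) (λ i → F (2 * i)) ℤ.+ sum< M (λ i → F (suc (2 * i)))
    ≡⟨ cong (λ s → sum< (suc M) (λ i → F (2 * i)) ℤ.+ s) (sum<-zero M odd-vanish) ⟩
  sum< (suc M) (λ i → F (2 * i)) ℤ.+ + 0
    ≡⟨ ℤₚ.+-identityʳ _ ⟩
  sum< (suc M) (λ i → F (2 * i))
    ≡⟨ cong (λ m → sum< m (λ i → F (2 * i))) (ℕₚ.+-suc a j) ⟨
  sum< (a + suc j) (λ i → F (2 * i))
    ≡⟨ sum<-+ a (suc j) (λ i → F (2 * i)) ⟩
  sum< a (λ i → F (2 * i)) ℤ.+ sum< (suc j) (λ x → F (2 * (a + x)))
    ≡⟨ trans (cong (ℤ._+ sum< (suc j) (λ x → F (2 * (a + x)))) (sum<-zero a low-vanish))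
             (ℤₚ.+-identityˡ _) ⟩
  F (2 * (a + 0)) ℤ.+ sum< j (λ x → F (2 * (a + suc x)))
    ≡⟨ cong₂ ℤ._+_ first (sum<-cong j λ x x<j → rest x x<j) ⟩
  coeff q (2 * a) ℤ.+ sum< j (λ x → + (2 * (a + suc x) C suc x) ℤ.* coeff q (2 * (a + suc x)))
    ∎
  where
  open ≡-Reasoning
  F : ℕ → ℤ
  F k = coeff q k ℤ.* coeff (joukowski-basis (2 * M) k) (2 * j)
  odd-vanish : ∀ i → i < M → F (suc (2 * i)) ≡ + 0
  odd-vanish i i<M = trans (cong (coeff q (suc (2 * i)) ℤ.*_) (coeff-basis-odd i j i<M))
                           (ℤₚ.*-zeroʳ (coeff q (suc (2 * i))))
  low-vanish : ∀ i → i < a → F (2 * i) ≡ + 0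
  low-vanish i i<a = trans (cong (coeff q (2 * i) ℤ.*_) (coeff-basis-low i j i<a))
                           (ℤₚ.*-zeroʳ (coeff q (2 * i)))
  first : F (2 * (a + 0)) ≡ coeff q (2 * a)
  first = begin
    coeff q (2 * (a + 0)) ℤ.* coeff (joukowski-basis (2 * M) (2 * (a + 0))) (2 * j)
      ≡⟨ cong (coeff q (2 * (a + 0)) ℤ.*_) (coeff-basis-mid a z≤n) ⟩
    coeff q (2 * (a + 0)) ℤ.* + 1
      ≡⟨ ℤₚ.*-identityʳ _ ⟩
    coeff q (2 * (a + 0))
      ≡⟨ cong (λ m → coeff q (2 * m)) (ℕₚ.+-identityʳ a) ⟩
    coeff q (2 * a)
      ∎
  rest : ∀ x → x < j → F (2 * (a + suc x)) ≡ + (2 * (a + suc x) C suc x) ℤ.* coeff q (2 * (a + suc x))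
  rest x x<j = trans (cong (coeff q (2 * (a + suc x)) ℤ.*_) (coeff-basis-mid a x<j))
                     (ℤₚ.*-comm (coeff q (2 * (a + suc x))) (+ (2 * (a + suc x) C suc x)))

coeff-t^⊕one-< : ∀ {d e} → 0 < e → e < d → coeff (t^ d ⊕ one) e ≡ + 0
coeff-t^⊕one-< {d} {suc e} _ e<d =
  trans (coeff-⊕ (t^ d) one (suc e)) (cong (ℤ._+ + 0) (coeff-shift-< one e<d))

dickson-leading : ∀ {M q} → 0 < M → Dickson (2 * M) q → coeff q (2 * M) ≡ + 1
dickson-leading {M} {q} (s≤s z≤n) (dickson q≤1+2M q-dickson) = begin
  coeff q (2 * M)                     ≡⟨ ℤₚ.+-identityʳ _ ⟨
  coeff q (2 * M) ℤ.+ + 0             ≡⟨ coeff-joukowski-even M 0 q (ℕₚ.+-identityʳ M) q≤1+2M ⟨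
  coeff (joukowski (2 * M) q) 0       ≡⟨ coeff-≡ q-dickson 0 ⟩
  coeff (t^ (2 * M + 2 * M) ⊕ one) 0  ≡⟨⟩
  + 1                                 ∎
  where open ≡-Reasoning

dickson-recurrence : ∀ {M q} a j → 1 ≤ j → a + j ≡ M → Dickson (2 * M) q →
  coeff q (2 * a) ≡ - sumFromTo (a + 1) M (λ i → + ((2 * i) C ((j + i) ∸ M)) ℤ.* coeff q (2 * i))
dickson-recurrence {M} {q} a j@(suc _) (s≤s z≤n) refl (dickson q≤1+2M q-dickson) = begin
  coeff q (2 * a)                 ≡⟨ inverseˡ-unique (coeff q (2 * a)) S vanish ⟩
  - S                             ≡⟨ cong -_ (sum<-cong j reindex) ⟩
  - sum< j (λ x → f (a + suc x))  ≡⟨ cong -_ (sumFromTo-shift a j f) ⟨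
  - sumFromTo (a + 1) M f         ∎
  where
  open ≡-Reasoning
  f : ℕ → ℤ
  f i = + ((2 * i) C ((j + i) ∸ M)) ℤ.* coeff q (2 * i)
  S : ℤ
  S = sum< j (λ x → + (2 * (a + suc x) C suc x) ℤ.* coeff q (2 * (a + suc x)))
  2j≤2M : 2 * j ≤ 2 * M
  2j≤2M = ℕₚ.*-monoʳ-≤ 2 (ℕₚ.m≤n+m j a)
  vanish : coeff q (2 * a) ℤ.+ S ≡ + 0
  vanish = begin
    coeff q (2 * a) ℤ.+ S                     ≡⟨ coeff-joukowski-even a j q refl q≤1+2M ⟨
    coeff (joukowski (2 * M) q) (2 * j)       ≡⟨ coeff-≡ q-dickson (2 * j) ⟩
    coeff (t^ (2 * M + 2 * M) ⊕ one) (2 * j)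
      ≡⟨ coeff-t^⊕one-< (s≤s z≤n)
           (ℕₚ.≤-<-trans 2j≤2M (ℕₚ.m<m+n (2 * M) (ℕₚ.<-≤-trans (s≤s z≤n) 2j≤2M))) ⟩
    + 0                                       ∎
  offset : ∀ x → (j + (a + suc x)) ∸ M ≡ suc x
  offset x = trans (cong (_∸ M) (regroup a j x)) (ℕₚ.m+n∸m≡n M (suc x))
    where
    regroup : ∀ a j x → j + (a + suc x) ≡ (a + j) + suc x
    regroup = ℕ-solve-∀
  reindex : ∀ x → x < j →
    + (2 * (a + suc x) C suc x) ℤ.* coeff q (2 * (a + suc x)) ≡ f (a + suc x)
  reindex x _ = cong (λ k → + ((2 * (a + suc x)) C k) ℤ.* coeff q (2 * (a + suc x))) (sym (offset x))

theorem2p1 : (n : ℕ) →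
    (c n (2 ^ (n + 1)) ≡ + 1) ×
    ((j : ℕ) → 1 ≤ j → j ≤ 2 ^ n →
      c n (2 ℕ.* (2 ^ n ∸ j)) ≡
        - sumFromTo (2 ^ n ∸ j + 1) (2 ^ n)
            (λ i → (+ ((2 ℕ.* i) C ((j + i) ∸ 2 ^ n))) ℤ.* c n (2 ℕ.* i)))
theorem2p1 n =
    trans (cong (λ k → c n (2 ^ k)) (ℕₚ.+-comm n 1)) (dickson-leading (ℕₚ.m^n>0 2 n) (dickson-p n))
  , λ j 1≤j j≤2ⁿ → dickson-recurrence (2 ^ n ∸ j) j 1≤j (ℕₚ.m∸n+n≡m j≤2ⁿ) (dickson-p n)
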